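{- For every positive integer $n$ and every $1\le i<n$, the statistic on $S_n$ equal to $1$ if $\sigma_i>\sigma_{i+1}$ and $0$ otherwise (the number of descents at position $i$) is $\frac12$-mesic with respect to the Lehmer code rotation.
   Context: A statistic $f$ is $c$-mesic with respect to a bijection $\mathcal{X}$ of a finite set if its average over every orbit of $\mathcal{X}$ equals $c$. Lehmer code: $L(\sigma)_i=\#\{j>i:\sigma_j<\sigma_i\}\in\{0,\dots,n-i\}$, a bijection from $S_n$ to such tuples. The Lehmer code rotation sends $\sigma$ to the unique $\tau$ with $L(\tau)_i\equiv L(\sigma)_i+1\pmod{n-i+1}$ for all $i$. -}

module Defs where

open import Data.Nat using (ℕ; zero; suc; _+_; _*_; _∸_; _<_; _<?_; NonZero)
open import Data.Nat.DivMod using (_%_)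
open import Data.Fin using (Fin; toℕ; fromℕ<; opposite)
open import Data.Fin.Properties using () renaming (_<?_ to _<ᶠ?_)
open import Data.List using (List; map; allFin)
open import Data.Nat.ListAction using (sum)
open import Data.Nat.Properties using (<-trans; n<1+n)
open import Data.Product using (_×_)
open import Function.Definitions using (Injective)
open import Relation.Binary.PropositionalEquality using (_≡_)
open import Relation.Nullary using (¬_; yes; no)
open import Relation.Nullary.Decidable using (⌊_⌋; _×-dec_)
open import Data.Bool using (Bool; true; false; if_then_else_)

-- Permutations of [n] = {0,…,n-1}: injective (hence bijective) maps Fin n → Fin n.
record Perm (n : ℕ) : Set where
  field
    fun : Fin n → Fin n
    inj : Injective _≡_ _≡_ fun
open Perm public

_≈ₚ_ : ∀ {n} → Perm n → Perm n → Set
σ ≈ₚ τ = ∀ i → fun σ i ≡ fun τ i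

sumTo : ℕ → (ℕ → ℕ) → ℕ
sumTo zero    g = 0
sumTo (suc p) g = sumTo p g + g p

iter : ∀ {A : Set} → (A → A) → ℕ → A → A
iter X zero    a = a
iter X (suc k) a = X (iter X k a)

-- Lehmer code (0-indexed positions): L(σ)_i = #{ j > i : σ_j < σ_i }
lehmer : ∀ {n} → Perm n → Fin n → ℕ
lehmer {n} σ i =
  sum (map (λ j → if ⌊ (i <ᶠ? j) ×-dec (fun σ j <ᶠ? fun σ i) ⌋ then 1 else 0) (allFin n))

-- The Lehmer code at 0-indexed position i ranges over {0,…,n-1-i}; modulus n - i.
-- suc (toℕ (opposite i)) = n - toℕ i.
lehmerModulus : ∀ {n} → Fin n → ℕ
lehmerModulus i = suc (toℕ (opposite i))

IsLehmerRotation : ∀ {n} → (Perm n → Perm n) → Set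
IsLehmerRotation {n} R =
  ∀ (σ : Perm n) (i : Fin n) →
    lehmer (R σ) i ≡ (lehmer σ i + 1) % lehmerModulus i

-- f is (a/b)-mesic w.r.t. X: for every σ with orbit of size p (minimal period),
-- the average (1/p) Σ_{k<p} f(X^k σ) equals a/b, i.e. b·Σ = a·p.
IsMesic : ∀ {n} → (Perm n → Perm n) → (Perm n → ℕ) → ℕ → ℕ → Set
IsMesic {n} X f a b =
  ∀ (σ : Perm n) (p : ℕ) → 0 < p → iter X p σ ≈ₚ σ →
    (∀ q → 0 < q → q < p → ¬ (iter X q σ ≈ₚ σ)) →
    b * sumTo p (λ k → f (iter X k σ)) ≡ a * p

-- Descent indicator at 1-indexed position i (1 ≤ i < n): 1 if σ_i > σ_{i+1}, else 0.
-- In 0-indexed terms: compares σ(i-1) and σ(i).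
descentAt : ∀ {n} (i : ℕ) → i < n → Perm n → ℕ
descentAt {n} zero    h σ = 0
descentAt {n} (suc i) h σ =
  if ⌊ fun σ (fromℕ< h) <ᶠ? fun σ (fromℕ< (<-trans (n<1+n i) h)) ⌋ then 1 else 0

-- Along an orbit of the rotation, the Lehmer entries at the adjacent positions i and i + 1 are
-- (a + k) mod (d + 1) and (b + k) mod d, where d + 1 = n - i, and σ has a descent at i exactly when
-- the entry at i + 1 is the smaller one. Hence the orbit length is a multiple of d (d + 1), and as k
-- runs over such a stretch the pair of entries runs equally often through every (x, y) with x < d
-- and y ≤ d, of which exactly half satisfy x < y.
module Submission where

open import Defs
open import Data.Nat using (ℕ; _≤_; _<_)

open import Data.Nat
open import Data.Nat.Properties
open import Data.Nat.DivMod
open import Data.Nat.Divisibility using (_∣_; divides; divides-refl)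
open import Data.Nat.Coprimality using (Coprime; coprime-+; coprime-divisor; 1-coprimeTo)
import Data.Nat.Coprimality as Coprimality
open import Data.Nat.ListAction using (sum)
open import Data.Nat.Tactic.RingSolver using (solve-∀)
open import Algebra.Properties.CommutativeSemigroup +-commutativeSemigroup using (interchange)
open import Algebra.Properties.CommutativeSemigroup *-commutativeSemigroup using (x∙yz≈y∙xz)
open import Data.Fin using (Fin; toℕ; fromℕ<; opposite) renaming (_<_ to _<ᶠ_)
open import Data.Fin.Properties using (toℕ-fromℕ<; toℕ-injective; toℕ<n; opposite-prop)
  renaming (_<?_ to _<ᶠ?_)
open import Data.List using ([]; _∷_; map; allFin)
open import Data.List.Membership.Propositional using (_∈_)
open import Data.List.Membership.Propositional.Properties using (∈-allFin)
open import Data.List.Relation.Unary.Any using (here; there)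
open import Data.List.Properties using (map-cong)
open import Data.Product using (_×_; _,_)
open import Data.Bool using (if_then_else_)
open import Function using (_∘_)
open import Relation.Nullary using (¬_; Dec; yes; no; contradiction)
open import Relation.Nullary.Decidable using (⌊_⌋; _×-dec_)
open import Relation.Binary.PropositionalEquality

𝟙[_] : {P : Set} → Dec P → ℕ
𝟙[ d ] = if ⌊ d ⌋ then 1 else 0

𝟙-mono : {P Q : Set} → (P → Q) → (d : Dec P) (e : Dec Q) → 𝟙[ d ] ≤ 𝟙[ e ]
𝟙-mono P⇒Q (yes p) (yes q) = ≤-refl
𝟙-mono P⇒Q (yes p) (no ¬q) = contradiction (P⇒Q p) ¬q
𝟙-mono P⇒Q (no ¬p) e       = z≤n

𝟙-strict : {P Q : Set} → ¬ P → Q → (d : Dec P) (e : Dec Q) → 𝟙[ d ] < 𝟙[ e ]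
𝟙-strict ¬p q (yes p)  e        = contradiction p ¬p
𝟙-strict ¬p q (no _)   (yes _)  = s≤s z≤n
𝟙-strict ¬p q (no _)   (no ¬q)  = contradiction q ¬q

𝟙-cong : {P Q : Set} → (P → Q) → (Q → P) → (d : Dec P) (e : Dec Q) → 𝟙[ d ] ≡ 𝟙[ e ]
𝟙-cong P⇒Q Q⇒P d e = ≤-antisym (𝟙-mono P⇒Q d e) (𝟙-mono Q⇒P e d)

Periodic : ℕ → (ℕ → ℕ) → Set
Periodic m f = ∀ k → f (k + m) ≡ f k

sumTo-cong : ∀ m {f g : ℕ → ℕ} → (∀ k → k < m → f k ≡ g k) → sumTo m f ≡ sumTo m g
sumTo-cong zero    f≗g = refl
sumTo-cong (suc m) f≗g = cong₂ _+_ (sumTo-cong m (λ k k<m → f≗g k (m<n⇒m<1+n k<m))) (f≗g m (n<1+n m))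

sumTo-+ : ∀ m n f → sumTo (m + n) f ≡ sumTo m f + sumTo n (λ k → f (m + k))
sumTo-+ m zero    f = trans (cong (λ z → sumTo z f) (+-identityʳ m)) (sym (+-identityʳ _))
sumTo-+ m (suc n) f = begin
  sumTo (m + suc n) f                                ≡⟨ cong (λ z → sumTo z f) (+-suc m n) ⟩
  sumTo (m + n) f + f (m + n)                        ≡⟨ cong (_+ f (m + n)) (sumTo-+ m n f) ⟩
  sumTo m f + sumTo n (λ k → f (m + k)) + f (m + n)  ≡⟨ +-assoc (sumTo m f) _ _ ⟩
  sumTo m f + (sumTo n (λ k → f (m + k)) + f (m + n)) ∎
  where open ≡-Reasoning

sumTo-const : ∀ r c → sumTo r (λ _ → c) ≡ r * c
sumTo-const zero    c = refl
sumTo-const (suc r) c = trans (cong (_+ c) (sumTo-const r c)) (+-comm (r * c) c)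

sumTo-*ˡ : ∀ m r f → sumTo m (λ k → r * f k) ≡ r * sumTo m f
sumTo-*ˡ zero    r f = sym (*-zeroʳ r)
sumTo-*ˡ (suc m) r f = trans (cong (_+ r * f m) (sumTo-*ˡ m r f)) (sym (*-distribˡ-+ r _ _))

sumTo-+-distrib : ∀ m (f g : ℕ → ℕ) → sumTo m (λ k → f k + g k) ≡ sumTo m f + sumTo m g
sumTo-+-distrib zero    f g = refl
sumTo-+-distrib (suc m) f g = begin
  sumTo m (λ k → f k + g k) + (f m + g m)  ≡⟨ cong (_+ (f m + g m)) (sumTo-+-distrib m f g) ⟩
  sumTo m f + sumTo m g + (f m + g m)      ≡⟨ interchange (sumTo m f) (sumTo m g) (f m) (g m) ⟩
  sumTo m f + f m + (sumTo m g + g m)      ∎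
  where open ≡-Reasoning

sumTo-swap : ∀ m n (h : ℕ → ℕ → ℕ) →
  sumTo m (λ q → sumTo n (λ s → h q s)) ≡ sumTo n (λ s → sumTo m (λ q → h q s))
sumTo-swap zero    n h = sym (trans (sumTo-const n 0) (*-zeroʳ n))
sumTo-swap (suc m) n h = trans (cong (_+ sumTo n (h m)) (sumTo-swap m n h))
  (sym (sumTo-+-distrib n (λ s → sumTo m (λ q → h q s)) (h m)))

sumTo-blocks : ∀ r m f → sumTo (r * m) f ≡ sumTo r (λ q → sumTo m (λ s → f (q * m + s)))
sumTo-blocks zero    m f = refl
sumTo-blocks (suc r) m f = begin
  sumTo (m + r * m) f                             ≡⟨ cong (λ z → sumTo z f) (+-comm m (r * m)) ⟩
  sumTo (r * m + m) f                             ≡⟨ sumTo-+ (r * m) m f ⟩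
  sumTo (r * m) f + sumTo m (λ s → f (r * m + s)) ≡⟨ cong (_+ sumTo m (λ s → f (r * m + s))) (sumTo-blocks r m f) ⟩
  sumTo r (λ q → sumTo m (λ s → f (q * m + s))) + sumTo m (λ s → f (r * m + s)) ∎
  where open ≡-Reasoning

sumTo-rotate : ∀ m f → f m ≡ f 0 → sumTo m (f ∘ suc) ≡ sumTo m f
sumTo-rotate m f fm≡f0 = +-cancelˡ-≡ (f 0) _ _ (begin
  f 0 + sumTo m (f ∘ suc)  ≡⟨ sumTo-+ 1 m f ⟨
  sumTo m f + f m          ≡⟨ cong (sumTo m f +_) fm≡f0 ⟩
  sumTo m f + f 0          ≡⟨ +-comm (sumTo m f) (f 0) ⟩
  f 0 + sumTo m f          ∎)
  where open ≡-Reasoning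

sumTo-shift : ∀ m f → Periodic m f → ∀ c → sumTo m (λ k → f (c + k)) ≡ sumTo m f
sumTo-shift m f per zero    = refl
sumTo-shift m f per (suc c) =
  trans (sumTo-shift m (f ∘ suc) (per ∘ suc) c) (sumTo-rotate m f (per 0))

sumTo-periods : ∀ m f → Periodic m f → ∀ r → sumTo (r * m) f ≡ r * sumTo m f
sumTo-periods m f per r = begin
  sumTo (r * m) f                                ≡⟨ sumTo-blocks r m f ⟩
  sumTo r (λ q → sumTo m (λ s → f (q * m + s)))  ≡⟨ sumTo-cong r (λ q _ → sumTo-shift m f per (q * m)) ⟩
  sumTo r (λ _ → sumTo m f)                      ≡⟨ sumTo-const r (sumTo m f) ⟩
  r * sumTo m f                                  ∎
  where open ≡-Reasoning

module _ (m : ℕ) .{{_ : NonZero m}} (g : ℕ → ℕ) (c : ℕ) where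

  sumTo-% : sumTo m (λ k → g ((c + k) % m)) ≡ sumTo m g
  sumTo-% = trans (sumTo-shift m (g ∘ (_% m)) (λ k → cong g ([m+n]%n≡m%n k m)) c)
                  (sumTo-cong m (λ k k<m → cong g (m<n⇒m%n≡m k<m)))

  sumTo-%-periods : ∀ r → sumTo (r * m) (λ k → g ((c + k) % m)) ≡ r * sumTo m g
  sumTo-%-periods r = trans (sumTo-periods m _ per r) (cong (r *_) sumTo-%)
    where
    per : Periodic m (λ k → g ((c + k) % m))
    per k = cong g (trans (cong (_% m) (sym (+-assoc c k m))) ([m+n]%n≡m%n (c + k) m))

sumTo-𝟙[<] : ∀ m x → sumTo m (λ k → 𝟙[ k <? x ]) ≡ m ⊓ x
sumTo-𝟙[<] zero    x = refl
sumTo-𝟙[<] (suc m) x with m <? x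
... | yes m<x = begin
  sumTo m (λ k → 𝟙[ k <? x ]) + 1  ≡⟨ cong (_+ 1) (trans (sumTo-𝟙[<] m x) (m≤n⇒m⊓n≡m (<⇒≤ m<x))) ⟩
  m + 1                            ≡⟨ +-comm m 1 ⟩
  suc m                            ≡⟨ m≤n⇒m⊓n≡m m<x ⟨
  suc m ⊓ x                        ∎
  where open ≡-Reasoning
... | no m≮x = begin
  sumTo m (λ k → 𝟙[ k <? x ]) + 0  ≡⟨ +-identityʳ _ ⟩
  sumTo m (λ k → 𝟙[ k <? x ])      ≡⟨ trans (sumTo-𝟙[<] m x) (m≥n⇒m⊓n≡n (≮⇒≥ m≮x)) ⟩
  x                                ≡⟨ m≥n⇒m⊓n≡n (m≤n⇒m≤1+n (≮⇒≥ m≮x)) ⟨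
  suc m ⊓ x                        ∎
  where open ≡-Reasoning

2*sumTo-id : ∀ m → 2 * sumTo (suc m) (λ k → k) ≡ suc m * m
2*sumTo-id zero    = refl
2*sumTo-id (suc m) = begin
  2 * (sumTo (suc m) (λ k → k) + suc m)      ≡⟨ *-distribˡ-+ 2 (sumTo (suc m) (λ k → k)) (suc m) ⟩
  2 * sumTo (suc m) (λ k → k) + 2 * suc m    ≡⟨ cong (_+ 2 * suc m) (2*sumTo-id m) ⟩
  suc m * m + 2 * suc m                      ≡⟨ gauss-step m ⟩
  suc (suc m) * suc m                        ∎
  where
  open ≡-Reasoning
  gauss-step : ∀ m → suc m * m + 2 * suc m ≡ suc (suc m) * suc m
  gauss-step = solve-∀

module _ (d : ℕ) .{{_ : NonZero d}} where

  count-%< : ∀ c x r → x ≤ d → sumTo (r * d) (λ q → 𝟙[ (c + q) % d <? x ]) ≡ r * x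
  count-%< c x r x≤d = begin
    sumTo (r * d) (λ q → 𝟙[ (c + q) % d <? x ])  ≡⟨ sumTo-%-periods d (λ y → 𝟙[ y <? x ]) c r ⟩
    r * sumTo d (λ y → 𝟙[ y <? x ])              ≡⟨ cong (r *_) (sumTo-𝟙[<] d x) ⟩
    r * (d ⊓ x)                                  ≡⟨ cong (r *_) (m≥n⇒m⊓n≡n x≤d) ⟩
    r * x                                        ∎
    where open ≡-Reasoning

  -- Write k = q (d + 1) + s with s ≤ d: for fixed s the residue of a + k mod d + 1 is constant,
  -- while that of b + k mod d runs r times through all residues as q ranges over r d values.
  2*count-%<%suc : ∀ a b {p} → d * suc d ∣ p →
    2 * sumTo p (λ k → 𝟙[ (b + k) % d <? (a + k) % suc d ]) ≡ p
  2*count-%<%suc a b (divides-refl r) = begin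
    2 * sumTo (r * (d * suc d)) f
      ≡⟨ cong (λ m → 2 * sumTo m f) (*-assoc r d (suc d)) ⟨
    2 * sumTo (r * d * suc d) f
      ≡⟨ cong (2 *_) (sumTo-blocks (r * d) (suc d) f) ⟩
    2 * sumTo (r * d) (λ q → sumTo (suc d) (λ s → f (q * suc d + s)))
      ≡⟨ cong (2 *_) (sumTo-cong (r * d) (λ q _ → sumTo-cong (suc d) (λ s _ → f-block q s))) ⟩
    2 * sumTo (r * d) (λ q → sumTo (suc d) (λ s → column s q))
      ≡⟨ cong (2 *_) (sumTo-swap (r * d) (suc d) (λ q s → column s q)) ⟩
    2 * sumTo (suc d) (λ s → sumTo (r * d) (column s))
      ≡⟨ cong (2 *_) (sumTo-cong (suc d) (λ s _ →
           count-%< (b + s) ((a + s) % suc d) r (≤-pred (m%n<n (a + s) (suc d))))) ⟩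
    2 * sumTo (suc d) (λ s → r * ((a + s) % suc d))
      ≡⟨ cong (2 *_) (sumTo-*ˡ (suc d) r (λ s → (a + s) % suc d)) ⟩
    2 * (r * sumTo (suc d) (λ s → (a + s) % suc d))
      ≡⟨ cong (λ z → 2 * (r * z)) (sumTo-% (suc d) (λ s → s) a) ⟩
    2 * (r * sumTo (suc d) (λ s → s))
      ≡⟨ x∙yz≈y∙xz 2 r _ ⟩
    r * (2 * sumTo (suc d) (λ s → s))
      ≡⟨ cong (r *_) (2*sumTo-id d) ⟩
    r * (suc d * d)
      ≡⟨ cong (r *_) (*-comm (suc d) d) ⟩
    r * (d * suc d)
      ∎
    where
    open ≡-Reasoning
    f : ℕ → ℕ
    f k = 𝟙[ (b + k) % d <? (a + k) % suc d ]
    column : ℕ → ℕ → ℕ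
    column s q = 𝟙[ (b + s + q) % d <? (a + s) % suc d ]
    b-block : ∀ b d q s → b + (q * suc d + s) ≡ b + s + q + q * d
    b-block = solve-∀
    a-block : ∀ a d q s → a + (q * suc d + s) ≡ a + s + q * suc d
    a-block = solve-∀
    f-block : ∀ q s → f (q * suc d + s) ≡ column s q
    f-block q s = cong₂ (λ u v → 𝟙[ u <? v ])
      (trans (cong (_% d) (b-block b d q s)) ([m+kn]%n≡m%n (b + s + q) q d))
      (trans (cong (_% suc d) (a-block a d q s)) ([m+kn]%n≡m%n (a + s) q (suc d)))

module _ {A : Set} {P Q : A → Set} (P? : ∀ x → Dec (P x)) (Q? : ∀ x → Dec (Q x))
         (P⇒Q : ∀ {x} → P x → Q x) where

  count-mono : ∀ xs → sum (map (λ x → 𝟙[ P? x ]) xs) ≤ sum (map (λ x → 𝟙[ Q? x ]) xs)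
  count-mono []       = z≤n
  count-mono (x ∷ xs) = +-mono-≤ (𝟙-mono P⇒Q (P? x) (Q? x)) (count-mono xs)

  count-strict : ∀ {xs y} → y ∈ xs → ¬ P y → Q y →
    sum (map (λ x → 𝟙[ P? x ]) xs) < sum (map (λ x → 𝟙[ Q? x ]) xs)
  count-strict {y ∷ xs} (here refl) ¬Py Qy = +-mono-<-≤ (𝟙-strict ¬Py Qy (P? y) (Q? y)) (count-mono xs)
  count-strict {x ∷ xs} (there y∈xs) ¬Py Qy = +-mono-≤-< (𝟙-mono P⇒Q (P? x) (Q? x)) (count-strict y∈xs ¬Py Qy)

module _ {n : ℕ} (τ : Perm n) where

  Inversion : Fin n → Fin n → Set
  Inversion i j = i <ᶠ j × fun τ j <ᶠ fun τ i

  inversion? : ∀ i j → Dec (Inversion i j)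
  inversion? i j = (i <ᶠ? j) ×-dec (fun τ j <ᶠ? fun τ i)

  lehmer-mono : ∀ {i j} → (∀ {k} → Inversion i k → Inversion j k) → lehmer τ i ≤ lehmer τ j
  lehmer-mono {i} {j} inv⊆ = count-mono (inversion? i) (inversion? j) inv⊆ (allFin n)

  lehmer-strict : ∀ {i j k} → (∀ {k} → Inversion i k → Inversion j k) →
    ¬ Inversion i k → Inversion j k → lehmer τ i < lehmer τ j
  lehmer-strict {i} {j} {k} inv⊆ ¬inv inv = count-strict (inversion? i) (inversion? j) inv⊆ (∈-allFin k) ¬inv inv

  module _ {i j : Fin n} (adjacent : toℕ j ≡ suc (toℕ i)) where

    i<j : i <ᶠ j
    i<j = ≤-reflexive (sym adjacent)

    descent⇒lehmer> : fun τ j <ᶠ fun τ i → lehmer τ j < lehmer τ i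
    descent⇒lehmer> τj<τi =
      lehmer-strict (λ (j<k , τk<τj) → <-trans i<j j<k , <-trans τk<τj τj<τi)
        (λ (j<j , _) → <-irrefl refl j<j) (i<j , τj<τi)

    -- An inversion (i, k) with k ≠ j is an inversion (j, k); k = j is excluded as τ i < τ j.
    ascent⇒lehmer≤ : fun τ i <ᶠ fun τ j → lehmer τ i ≤ lehmer τ j
    ascent⇒lehmer≤ τi<τj = lehmer-mono λ {k} (i<k , τk<τi) →
      let k≢j : toℕ j ≢ toℕ k
          k≢j j≡k = <-asym τi<τj (subst (λ l → fun τ l <ᶠ fun τ i) (toℕ-injective (sym j≡k)) τk<τi)
      in ≤∧≢⇒< (subst (_≤ toℕ k) (sym adjacent) i<k) k≢j , <-trans τk<τi τi<τj

    𝟙[descent]≡𝟙[lehmer>] : 𝟙[ fun τ j <ᶠ? fun τ i ] ≡ 𝟙[ lehmer τ j <? lehmer τ i ]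
    𝟙[descent]≡𝟙[lehmer>] = 𝟙-cong descent⇒lehmer> lehmer>⇒descent (fun τ j <ᶠ? fun τ i) (lehmer τ j <? lehmer τ i)
      where
      τi≢τj : toℕ (fun τ i) ≢ toℕ (fun τ j)
      τi≢τj eq = <-irrefl (cong toℕ (inj τ (toℕ-injective eq))) i<j
      lehmer>⇒descent : lehmer τ j < lehmer τ i → fun τ j <ᶠ fun τ i
      lehmer>⇒descent lj<li with fun τ j <ᶠ? fun τ i
      ... | yes τj<τi = τj<τi
      ... | no  τj≮τi = contradiction lj<li (≤⇒≯ (ascent⇒lehmer≤ (≤∧≢⇒< (≮⇒≥ τj≮τi) τi≢τj)))

lehmer-cong : ∀ {n} (σ τ : Perm n) → σ ≈ₚ τ → ∀ i → lehmer σ i ≡ lehmer τ i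
lehmer-cong {n} σ τ σ≈τ i = cong sum (map-cong (λ j →
  cong₂ (λ u v → 𝟙[ (i <ᶠ? j) ×-dec (u <ᶠ? v) ]) (σ≈τ j) (σ≈τ i)) (allFin n))

lehmerModulus-adjacent : ∀ {n} {i j : Fin n} → toℕ j ≡ suc (toℕ i) →
  lehmerModulus i ≡ suc (lehmerModulus j)
lehmerModulus-adjacent {n} {i} {j} adjacent = cong suc (begin
  toℕ (opposite i)             ≡⟨ opposite-prop i ⟩
  suc n ∸ suc (suc (toℕ i))    ≡⟨ +-∸-assoc 1 (subst (_< n) adjacent (toℕ<n j)) ⟩
  suc (n ∸ suc (suc (toℕ i)))  ≡⟨ cong (λ t → suc (n ∸ suc t)) adjacent ⟨
  suc (n ∸ suc (toℕ j))        ≡⟨ cong suc (opposite-prop j) ⟨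
  suc (toℕ (opposite j))       ∎)
  where open ≡-Reasoning

[m%n+o]%n≡[m+o]%n : ∀ m o n .{{_ : NonZero n}} → (m % n + o) % n ≡ (m + o) % n
[m%n+o]%n≡[m+o]%n m o n = begin
  (m % n + o) % n            ≡⟨ %-distribˡ-+ (m % n) o n ⟩
  (m % n % n + o % n) % n    ≡⟨ cong (λ z → (z + o % n) % n) (m%n%n≡m%n m n) ⟩
  (m % n + o % n) % n        ≡⟨ %-distribˡ-+ m o n ⟨
  (m + o) % n                ∎
  where open ≡-Reasoning

[m+n]%o≡m⇒o∣n : ∀ m n o .{{_ : NonZero o}} → (m + n) % o ≡ m → o ∣ n
[m+n]%o≡m⇒o∣n m n o eq = divides ((m + n) / o) (+-cancelˡ-≡ m _ _ (begin
  m + n                        ≡⟨ m≡m%n+[m/n]*n (m + n) o ⟩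
  (m + n) % o + (m + n) / o * o ≡⟨ cong (_+ (m + n) / o * o) eq ⟩
  m + (m + n) / o * o          ∎))
  where open ≡-Reasoning

n⊥1+n : ∀ n → Coprime n (suc n)
n⊥1+n n = Coprimality.sym (subst (λ m → Coprime m n) (+-comm n 1) (coprime-+ (1-coprimeTo n)))

∣∧1+∣⇒*∣ : ∀ {d p} → d ∣ p → suc d ∣ p → d * suc d ∣ p
∣∧1+∣⇒*∣ {d} d∣p (divides-refl q) with coprime-divisor (n⊥1+n d) (subst (d ∣_) (*-comm q (suc d)) d∣p)
... | divides-refl r = divides r (*-assoc r d (suc d))

module _ {n : ℕ} {R : Perm n → Perm n} (rotation : IsLehmerRotation R) (σ : Perm n) where

  lehmer-iter : ∀ i → lehmer σ i < lehmerModulus i →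
    ∀ k → lehmer (iter R k σ) i ≡ (lehmer σ i + k) % lehmerModulus i
  lehmer-iter i ℓ<M zero = sym (trans (cong (_% lehmerModulus i) (+-identityʳ (lehmer σ i))) (m<n⇒m%n≡m ℓ<M))
  lehmer-iter i ℓ<M (suc k) = begin
    lehmer (R (iter R k σ)) i      ≡⟨ rotation (iter R k σ) i ⟩
    (lehmer (iter R k σ) i + 1) % M ≡⟨ cong (λ z → (z + 1) % M) (lehmer-iter i ℓ<M k) ⟩
    ((ℓ + k) % M + 1) % M           ≡⟨ [m%n+o]%n≡[m+o]%n (ℓ + k) 1 M ⟩
    (ℓ + k + 1) % M                 ≡⟨ cong (_% M) (trans (+-assoc ℓ k 1) (cong (ℓ +_) (+-comm k 1))) ⟩
    (ℓ + suc k) % M                 ∎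
    where
    open ≡-Reasoning
    ℓ = lehmer σ i
    M = lehmerModulus i

  module _ (p : ℕ) (periodic : iter R (suc p) σ ≈ₚ σ) where

    lehmer<lehmerModulus : ∀ i → lehmer σ i < lehmerModulus i
    lehmer<lehmerModulus i = subst (_< lehmerModulus i)
      (trans (sym (rotation (iter R p σ) i)) (lehmer-cong (iter R (suc p) σ) σ periodic i))
      (m%n<n (lehmer (iter R p σ) i + 1) (lehmerModulus i))

    lehmer-orbit : ∀ i k → lehmer (iter R k σ) i ≡ (lehmer σ i + k) % lehmerModulus i
    lehmer-orbit i = lehmer-iter i (lehmer<lehmerModulus i)

    lehmerModulus∣period : ∀ i → lehmerModulus i ∣ suc p
    lehmerModulus∣period i = [m+n]%o≡m⇒o∣n (lehmer σ i) (suc p) (lehmerModulus i)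
      (trans (sym (lehmer-orbit i (suc p))) (lehmer-cong (iter R (suc p) σ) σ periodic i))

theorem4p18 : (n : ℕ) → 1 ≤ n → (i : ℕ) → 1 ≤ i → (h : i < n) →
    (R : Perm n → Perm n) → IsLehmerRotation R →
    IsMesic R (descentAt i h) 1 2
theorem4p18 n _ zero () h
theorem4p18 n _ (suc i) _ h R rotation σ zero () _ _
theorem4p18 n _ (suc i) _ h R rotation σ (suc p) _ periodic _ = begin
  2 * sumTo (suc p) (λ k → descentAt (suc i) h (iter R k σ))
    ≡⟨ cong (2 *_) (sumTo-cong (suc p) (λ k _ → descent-on-orbit k)) ⟩
  2 * sumTo (suc p) (λ k → 𝟙[ (b + k) % d <? (a + k) % suc d ])
    ≡⟨ 2*count-%<%suc d a b (∣∧1+∣⇒*∣ (modulus∣period i₁) (subst (_∣ suc p) M≡1+d (modulus∣period i₀))) ⟩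
  suc p
    ≡⟨ *-identityˡ (suc p) ⟨
  1 * suc p ∎
  where
  open ≡-Reasoning
  i₀ i₁ : Fin n
  i₀ = fromℕ< (<-trans (n<1+n i) h)
  i₁ = fromℕ< h
  adjacent : toℕ i₁ ≡ suc (toℕ i₀)
  adjacent = trans (toℕ-fromℕ< h) (cong suc (sym (toℕ-fromℕ< (<-trans (n<1+n i) h))))
  a b d : ℕ
  a = lehmer σ i₀
  b = lehmer σ i₁
  d = lehmerModulus i₁
  M≡1+d : lehmerModulus i₀ ≡ suc d
  M≡1+d = lehmerModulus-adjacent adjacent
  modulus∣period : ∀ i → lehmerModulus i ∣ suc p
  modulus∣period = lehmerModulus∣period rotation σ p periodic
  descent-on-orbit : ∀ k → descentAt (suc i) h (iter R k σ) ≡ 𝟙[ (b + k) % d <? (a + k) % suc d ]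
  descent-on-orbit k = trans (𝟙[descent]≡𝟙[lehmer>] (iter R k σ) adjacent)
    (cong₂ (λ u v → 𝟙[ u <? v ]) (lehmer-orbit rotation σ p periodic i₁ k)
      (trans (lehmer-orbit rotation σ p periodic i₀ k) (%-congʳ {o = a + k} M≡1+d)))
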